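{- Let $C$ be a set and $\prec$ a Lehmann hyper-order on $C$. Let $D$ be the set of $c\in C$ with $\{c\}$ insignificant, let $L(A)=D\cup\{c\in C:\{c\}\prec A\}$ for $A\subseteq C$, and define $T(A)=A\setminus L(A)$. Then $T$ is a Plott function on $C$.
   Context: A choice function on $C$ is a map $T:2^C\to2^C$ with $T(X)\subseteq X$; it is a Plott function if $T(X\cup Y)=T(T(X)\cup Y)$ for all $X,Y\subseteq C$. A hyper-relation on $C$ is a binary relation $\prec$ on the set of subsets of $C$. A set $B\subseteq C$ is essential if $\emptyset\prec B$ and insignificant otherwise. A Lehmann hyper-order is a hyper-relation satisfying: (L0) irreflexivity; (L1) if $A'\subseteq A\prec B$ then $A'\prec B$; (L2) if $(A_i)_{i\in I}$ is a nonempty family with $A_i\prec B$ for all $i$, then $\bigcup_iA_i\prec B$; (L3) if $A\prec B\subseteq B'$ then $A\prec B'$; (L4) if $A\prec A\cup B$ then $A\prec B$; (L5) if $A$ is essential and $B$ is insignificant then $B\prec A$. -}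

module Defs where

open import Level using (Level; Lift; suc; _⊔_)
open import Data.Empty using (⊥)
open import Data.Product using (_×_; Σ)
open import Relation.Nullary using (¬_)
open import Relation.Unary using (Pred; _⊆_; _≐_; _∪_; _∖_; ⋃; ｛_｝)

Subset : ∀ {ℓ} → Set ℓ → Set (suc ℓ)
Subset {ℓ} C = Pred C ℓ

∅ˢ : ∀ {ℓ} {C : Set ℓ} → Subset C
∅ˢ {ℓ} _ = Lift ℓ ⊥

HyperRel : ∀ {ℓ} → Set ℓ → Set (suc ℓ)
HyperRel {ℓ} C = Subset C → Subset C → Set ℓ

module _ {ℓ} {C : Set ℓ} (_≺_ : HyperRel C) where

  -- Since subsets are predicates, a relation "on sets" must not
  -- distinguish extensionally equal predicates.
  RespectsSetEq : Set (suc ℓ)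
  RespectsSetEq = ∀ {A A' B B' : Subset C} → A ≐ A' → B ≐ B' → A ≺ B → A' ≺ B'

  Essential : Subset C → Set ℓ
  Essential B = ∅ˢ ≺ B

  Insignificant : Subset C → Set ℓ
  Insignificant B = ¬ (∅ˢ ≺ B)

  record IsLehmannHyperOrder : Set (suc ℓ) where
    field
      L0 : ∀ (A : Subset C) → ¬ (A ≺ A)
      L1 : ∀ {A' A B : Subset C} → A' ⊆ A → A ≺ B → A' ≺ B
      L2 : ∀ (I : Set ℓ) → I → (A : I → Subset C) (B : Subset C) →
           (∀ i → A i ≺ B) → ⋃ I A ≺ B
      L3 : ∀ {A B B' : Subset C} → A ≺ B → B ⊆ B' → A ≺ B'
      L4 : ∀ {A B : Subset C} → A ≺ (A ∪ B) → A ≺ B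
      L5 : ∀ {A B : Subset C} → Essential A → Insignificant B → B ≺ A

  D : Subset C
  D c = Insignificant ｛ c ｝

  L : Subset C → Subset C
  L A = D ∪ (λ c → ｛ c ｝ ≺ A)

  T : Subset C → Subset C
  T A = A ∖ L A

IsChoiceFunction : ∀ {ℓ} {C : Set ℓ} → (Subset C → Subset C) → Set (suc ℓ)
IsChoiceFunction {C = C} F = ∀ (X : Subset C) → F X ⊆ X

IsPlott : ∀ {ℓ} {C : Set ℓ} → (Subset C → Subset C) → Set (suc ℓ)
IsPlott {C = C} F = IsChoiceFunction F ×
  (∀ (X Y : Subset C) → F (X ∪ Y) ≐ F (F X ∪ Y))

{-# OPTIONS --safe #-}
module Submission where

-- L is monotone (L3), and removing from a menu A elements that A rejects
-- does not shrink L A: if {c} ≺ A, then {c} together with the removed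
-- elements is a union of singletons each below A (those in D by L5),
-- hence below A by L2, and by L4 it is below the reduced menu. So T is
-- unchanged by such removals, and T X ∪ Y arises from X ∪ Y in this way.

open import Defs
open import Level using (Level)
open import Axiom.ExcludedMiddle using (ExcludedMiddle)
open import Data.Product using (Σ; _,_; proj₁; proj₂)
open import Data.Sum using (inj₁; inj₂; map₁)
open import Data.Empty using (⊥-elim)
open import Function using (id; _∘_)
open import Relation.Nullary using (yes; no)
open import Relation.Unary using (_⊆_; _≐_; _∪_; _∖_; ⋃; ｛_｝; _∈_)
open import Relation.Binary.PropositionalEquality using (refl)

⊆-∖-∪ : ∀ {ℓ} → ExcludedMiddle ℓ → {C : Set ℓ} {A B : Subset C} → A ⊆ (A ∖ B) ∪ B
⊆-∖-∪ em {B = B} {a} a∈A with em {a ∈ B}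
... | yes a∈B = inj₂ a∈B
... | no a∉B  = inj₁ (a∈A , a∉B)

module LehmannChoice {ℓ : Level} (em : ExcludedMiddle ℓ) {C : Set ℓ} (_≺_ : HyperRel C)
  (resp : RespectsSetEq _≺_) (lehmann : IsLehmannHyperOrder _≺_) where
  open IsLehmannHyperOrder lehmann

  L-mono : ∀ {A B : Subset C} → A ⊆ B → L _≺_ A ⊆ L _≺_ B
  L-mono A⊆B (inj₁ x∈D)  = inj₁ x∈D
  L-mono A⊆B (inj₂ x≺A) = inj₂ (L3 x≺A A⊆B)

  ≺-from-singletons : ∀ {E A : Subset C} {c : C} → c ∈ E →
                      (∀ {x} → x ∈ E → ｛ x ｝ ≺ A) → E ≺ A
  ≺-from-singletons {E} {A} {c} c∈E singletons≺A =
    resp ⋃≐E (id , id) (L2 I (c , c∈E) (λ i → ｛ proj₁ i ｝) A (λ i → singletons≺A (proj₂ i)))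
    where
      I : Set ℓ
      I = Σ C (_∈ E)
      ⋃≐E : ⋃ I (λ i → ｛ proj₁ i ｝) ≐ E
      ⋃≐E = (λ { ((x , x∈E) , refl) → x∈E }) , (λ {x} x∈E → (x , x∈E) , refl)

  singleton≺-from-L : ∀ {A : Subset C} {x : C} → Essential _≺_ A → x ∈ L _≺_ A → ｛ x ｝ ≺ A
  singleton≺-from-L A-essential (inj₁ x∈D)  = L5 A-essential x∈D
  singleton≺-from-L A-essential (inj₂ x≺A) = x≺A

  L-⊆-removing-rejected : ∀ {A A' : Subset C} → A ∖ A' ⊆ L _≺_ A → L _≺_ A ⊆ L _≺_ A'
  L-⊆-removing-rejected removed⊆LA (inj₁ c∈D)              = inj₁ c∈D
  L-⊆-removing-rejected {A} {A'} removed⊆LA {c} (inj₂ c≺A) = inj₂ (L1 inj₁ E≺A')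
    where
      E : Subset C
      E = ｛ c ｝ ∪ (A ∖ A')
      E⊆LA : E ⊆ L _≺_ A
      E⊆LA (inj₁ refl)   = inj₂ c≺A
      E⊆LA (inj₂ removed) = removed⊆LA removed
      E≺A : E ≺ A
      E≺A = ≺-from-singletons (inj₁ refl) λ x∈E → singleton≺-from-L (L1 (λ ()) c≺A) (E⊆LA x∈E)
      E≺A' : E ≺ A'
      E≺A' = L4 (L3 E≺A (map₁ inj₂ ∘ ⊆-∖-∪ em {A = A} {A'}))

  T-≐-removing-rejected : ∀ {A A' : Subset C} → A' ⊆ A → A ∖ A' ⊆ L _≺_ A →
                          T _≺_ A ≐ T _≺_ A'
  T-≐-removing-rejected {A} {A'} A'⊆A removed⊆LA = TA⊆TA' , TA'⊆TA
    where
      TA⊆TA' : T _≺_ A ⊆ T _≺_ A'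
      TA⊆TA' {x} (x∈A , x∉LA) with em {x ∈ A'}
      ... | yes x∈A' = x∈A' , x∉LA ∘ L-mono A'⊆A
      ... | no x∉A'  = ⊥-elim (x∉LA (removed⊆LA (x∈A , x∉A')))
      TA'⊆TA : T _≺_ A' ⊆ T _≺_ A
      TA'⊆TA (x∈A' , x∉LA') = A'⊆A x∈A' , x∉LA' ∘ L-⊆-removing-rejected removed⊆LA

  ∖T⊆L : ∀ {A : Subset C} → A ∖ T _≺_ A ⊆ L _≺_ A
  ∖T⊆L {A} {x} (x∈A , x∉TA) with em {x ∈ L _≺_ A}
  ... | yes x∈LA = x∈LA
  ... | no x∉LA  = ⊥-elim (x∉TA (x∈A , x∉LA))

  T-plott : ∀ (X Y : Subset C) → T _≺_ (X ∪ Y) ≐ T _≺_ (T _≺_ X ∪ Y)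
  T-plott X Y = T-≐-removing-rejected (map₁ proj₁) removed⊆L
    where
      removed⊆L : (X ∪ Y) ∖ (T _≺_ X ∪ Y) ⊆ L _≺_ (X ∪ Y)
      removed⊆L (inj₁ x∈X , x∉TX∪Y) = L-mono inj₁ (∖T⊆L (x∈X , x∉TX∪Y ∘ inj₁))
      removed⊆L (inj₂ x∈Y , x∉TX∪Y) = ⊥-elim (x∉TX∪Y (inj₂ x∈Y))

propositionA3 : ∀ {ℓ : Level} → ExcludedMiddle ℓ →
    (C : Set ℓ) (_≺_ : HyperRel C) → RespectsSetEq _≺_ →
    IsLehmannHyperOrder _≺_ → IsPlott (T _≺_)
propositionA3 em C _≺_ resp lehmann = (λ X → proj₁) , T-plott
  where open LehmannChoice em _≺_ resp lehmann
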